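{- Let $(\mathcal{A},B)$ be an instance of \textsc{3-Partition} and let $\mathcal{S}$ be the degree sequence constructed from it as described in the context. If $(\mathcal{A},B)$ is a yes-instance of \textsc{3-Partition}, then there is a dag realizing $\mathcal{S}$.
   Context: \textsc{3-Partition}: given a sequence $\mathcal{A}=a_1,\ldots,a_{3m}$ of positive integers and an integer $B$ with $\sum_{i=1}^{3m}a_i=mB$ and $B/4<a_i<B/2$ for all $i$, decide whether the $3m$ integers can be partitioned into $m$ disjoint triples each summing to $B$. A degree sequence is a multiset of pairs $\binom{a}{b}$ of nonnegative integers ($a$ = prescribed indegree, $b$ = prescribed outdegree); a dag (directed acyclic graph without parallel arcs and self-loops) realizes it if its vertices can be put in bijection with the elements so that each vertex has the indegree and outdegree of its element. Construction: $\mathcal{S}$ is the multiset consisting of $\alpha_i=\binom{a_i}{a_i}$ for $1\le i\le 3m$, together with the elements of $X_0,\ldots,X_m$, where $X_0=\{x_0^j: 0\le j\le B-1\}$ with $x_0^j=\binom{j}{2mB-j}$; $X_m=\{x_m^j:0\le j\le B-1\}$ with $x_m^j=\binom{(2m-1)B+j+1}{B-1-j}$; and for $0<i<m$, $X_i=\{x_i^j:0\le j\le 2B-1\}$ with $x_i^j=\binom{(2i-1)B+j+1}{(2m-2i+1)B-1-j}$ if $j<B$ and $x_i^j=\binom{(2i-1)B+j}{(2m-2i+1)B-j}$ if $j\ge B$. -}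

module Defs where

open import Data.Nat using (ℕ; zero; suc; _+_; _*_; _∸_; _<_; _≤_)
open import Data.Bool using (Bool; true; false; if_then_else_)
open import Data.Fin using (Fin; _≟_)
open import Data.List using (List; []; _∷_; _++_; map; upTo; concatMap; length; allFin; lookup)
open import Data.Product using (_×_; _,_; Σ; proj₁; proj₂)
open import Data.Nat.ListAction using (sum)
open import Relation.Binary.PropositionalEquality using (_≡_)
open import Relation.Nullary using (¬_)
open import Relation.Nullary.Decidable using (⌊_⌋)
open import Relation.Binary.Construct.Closure.Transitive using (TransClosure)

sumFin : {n : ℕ} → (Fin n → ℕ) → ℕ
sumFin {n} f = sum (map f (allFin n))

countFin : {n : ℕ} → (Fin n → Bool) → ℕ
countFin p = sumFin (λ u → if p u then 1 else 0)

Is3PartitionInstance : (m B : ℕ) → (Fin (3 * m) → ℕ) → Set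
Is3PartitionInstance m B a =
  sumFin a ≡ m * B ×
  ((i : Fin (3 * m)) → (0 < a i) × (B < 4 * a i) × (2 * a i < B))

Yes3Partition : (m B : ℕ) → (Fin (3 * m) → ℕ) → Set
Yes3Partition m B a =
  Σ (Fin (3 * m) → Fin m) λ t →
    (k : Fin m) →
      countFin (λ i → ⌊ t i ≟ k ⌋) ≡ 3 ×
      sumFin (λ i → if ⌊ t i ≟ k ⌋ then a i else 0) ≡ B

-- An element (a , b): a = prescribed indegree, b = prescribed outdegree.
DegSeq : Set
DegSeq = List (ℕ × ℕ)

-- A simple digraph on vertex set Fin n: arc u → v iff arc u v ≡ true
-- (a relation, hence no parallel arcs).
Digraph : ℕ → Set
Digraph n = Fin n → Fin n → Bool

Arc : {n : ℕ} → Digraph n → Fin n → Fin n → Set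
Arc G u v = G u v ≡ true

IsDag : {n : ℕ} → Digraph n → Set
IsDag {n} G =
  ((v : Fin n) → ¬ Arc G v v) ×
  ((v : Fin n) → ¬ TransClosure (Arc G) v v)

indeg : {n : ℕ} → Digraph n → Fin n → ℕ
indeg G v = countFin (λ u → G u v)

outdeg : {n : ℕ} → Digraph n → Fin n → ℕ
outdeg G u = countFin (λ v → G u v)

-- A dag realizes S: its vertices are in bijection with the elements of S
-- (we identify the vertex set with the positions Fin (length S) of S)
-- and each vertex has the prescribed in- and outdegree.
Realizes : (n : ℕ) → Digraph n → DegSeq → Set
Realizes n G S =
  Σ (Fin n → Fin (length S)) λ f →
  Σ (Fin (length S) → Fin n) λ g →
    ((x : Fin n) → g (f x) ≡ x) ×
    ((y : Fin (length S)) → f (g y) ≡ y) ×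
    ((x : Fin n) → indeg G x ≡ proj₁ (lookup S (f x)) ×
                   outdeg G x ≡ proj₂ (lookup S (f x)))

HasDagRealization : DegSeq → Set
HasDagRealization S = Σ ℕ λ n → Σ (Digraph n) λ G → IsDag G × Realizes n G S

X₀ : ℕ → ℕ → DegSeq
X₀ m B = map (λ j → (j , 2 * m * B ∸ j)) (upTo B)

Xₘ : ℕ → ℕ → DegSeq
Xₘ m B = map (λ j → ((2 * m ∸ 1) * B + j + 1 , B ∸ 1 ∸ j)) (upTo B)

Xᵢ : ℕ → ℕ → ℕ → DegSeq
Xᵢ m B i =
  map (λ j → ((2 * i ∸ 1) * B + j + 1 , (2 * m ∸ 2 * i + 1) * B ∸ 1 ∸ j)) (upTo B) ++
  map (λ j → ((2 * i ∸ 1) * B + j , (2 * m ∸ 2 * i + 1) * B ∸ j)) (map (B +_) (upTo B))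

constructS : (m B : ℕ) → (Fin (3 * m) → ℕ) → DegSeq
constructS m B a =
  map (λ i → (a i , a i)) (allFin (3 * m)) ++
  X₀ m B ++
  concatMap (Xᵢ m B) (map suc (upTo (m ∸ 1))) ++
  Xₘ m B

-- The 2mB vertices of X₀, …, Xₘ, listed in the order of the paper's
-- indices, form a transitive tournament (the chain).  Cut the chain into
-- 2m segments of length B and let block k, made of segments 2k and 2k+1,
-- serve the k-th triple: element αᵢ of the triple receives an arc from aᵢ
-- consecutive vertices of segment 2k and sends an arc to aᵢ consecutive
-- vertices of segment 2k+1, which is possible because the triple sums to
-- B.  The vertex at position p of the chain then has in-degree p plus the
-- arc it may receive and out-degree 2mB - 1 - p plus the arc it may send,
-- which are its prescribed degrees; placing each triple between the two
-- segments of its block gives a topological order, so the digraph is a dag.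
module Submission where

open import Defs
open import Data.Bool using (Bool; true; false; T; if_then_else_; not; _∧_)
open import Data.Bool.Properties using (T-≡)
open import Data.Fin using (Fin; zero; suc; toℕ; fromℕ<; cast)
import Data.Fin as Fin
open import Data.Fin.Properties using (toℕ<n; toℕ-fromℕ<; cast-trans; cast-is-id)
open import Data.List
  using (List; []; _∷_; _++_; map; concat; concatMap; upTo; applyUpTo; allFin; length; lookup)
open import Data.List.Properties
  using ( map-++; map-∘; map-cong; map-cong-local; map-tabulate; length-map; map-applyUpTo
        ; map-concatMap; concatMap-map; concatMap-cong; ++-assoc; ++-identityʳ )
open import Data.List.Membership.Propositional.Properties using (∈-lookup)
open import Data.List.Relation.Unary.All as All using (All)
open import Data.List.Relation.Unary.All.Properties
  using (++⁺; map⁺; concat⁺; applyUpTo⁺₁; tabulate⁺)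
open import Data.Nat
open import Data.Nat.Properties
open import Data.Nat.ListAction using (sum)
open import Data.Nat.ListAction.Properties using (sum-++)
open import Data.Nat.Tactic.RingSolver using (solve-∀)
open import Data.Product using (_×_; _,_; proj₁; proj₂)
open import Data.Unit using (⊤; tt)
open import Function using (_∘_; id; Equivalence)
open import Relation.Binary.PropositionalEquality
open import Relation.Binary.Construct.Closure.Transitive using (TransClosure; [_]; _∷_)
open import Relation.Nullary.Decidable using (⌊_⌋; ⌊⌋-map′)

private
  variable
    A C : Set

-- Finite sums and lists

ind : Bool → ℕ
ind b = if b then 1 else 0

∑ : ℕ → (ℕ → ℕ) → ℕ
∑ zero    f = 0
∑ (suc n) f = f 0 + ∑ n (f ∘ suc)

∑-cong : ∀ n {f g : ℕ → ℕ} → (∀ {i} → i < n → f i ≡ g i) → ∑ n f ≡ ∑ n g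
∑-cong zero    eq = refl
∑-cong (suc n) eq = cong₂ _+_ (eq z<s) (∑-cong n (eq ∘ s<s))

∑-zero : ∀ n → ∑ n (λ _ → 0) ≡ 0
∑-zero zero    = refl
∑-zero (suc n) = ∑-zero n

∑-one : ∀ n → ∑ n (λ _ → 1) ≡ n
∑-one zero    = refl
∑-one (suc n) = cong suc (∑-one n)

∑-+ : ∀ a b f → ∑ (a + b) f ≡ ∑ a f + ∑ b (λ r → f (a + r))
∑-+ zero    b f = refl
∑-+ (suc a) b f = trans (cong (f 0 +_) (∑-+ a b (f ∘ suc))) (sym (+-assoc (f 0) _ _))

∑-* : ∀ m c f → ∑ (m * c) f ≡ ∑ m (λ k → ∑ c (λ r → f (k * c + r)))
∑-* zero    c f = refl
∑-* (suc m) c f = begin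
  ∑ (c + m * c) f
    ≡⟨ ∑-+ c (m * c) f ⟩
  ∑ c f + ∑ (m * c) (λ r → f (c + r))
    ≡⟨ cong (∑ c f +_) (∑-* m c (λ r → f (c + r))) ⟩
  ∑ c f + ∑ m (λ k → ∑ c (λ r → f (c + (k * c + r))))
    ≡⟨ cong (∑ c f +_) (∑-cong m λ {k} _ → ∑-cong c λ {r} _ → cong f (sym (+-assoc c (k * c) r))) ⟩
  ∑ c f + ∑ m (λ k → ∑ c (λ r → f (c + k * c + r))) ∎
  where open ≡-Reasoning

∑-one-hot : ∀ n x v → x < n → ∑ n (λ k → if x ≡ᵇ k then v else 0) ≡ v
∑-one-hot (suc n) zero    v _         = trans (cong (v +_) (∑-zero n)) (+-identityʳ v)
∑-one-hot (suc n) (suc x) v (s≤s x<n) = ∑-one-hot n x v x<n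

sum-map-upTo : ∀ n (f : ℕ → ℕ) → sum (map f (upTo n)) ≡ ∑ n f
sum-map-upTo n f = sum-map-applyUpTo n id
  where
  sum-map-applyUpTo : ∀ n g → sum (map f (applyUpTo g n)) ≡ ∑ n (f ∘ g)
  sum-map-applyUpTo zero    g = refl
  sum-map-applyUpTo (suc n) g = cong (f (g 0) +_) (sum-map-applyUpTo n (g ∘ suc))

sum-map-concatMap : (g : C → ℕ) (F : A → List C) (xs : List A) →
  sum (map g (concatMap F xs)) ≡ sum (map (λ x → sum (map g (F x))) xs)
sum-map-concatMap g F []       = refl
sum-map-concatMap g F (x ∷ xs) = begin
  sum (map g (F x ++ concatMap F xs))          ≡⟨ cong sum (map-++ g (F x) _) ⟩
  sum (map g (F x) ++ map g (concatMap F xs))  ≡⟨ sum-++ (map g (F x)) _ ⟩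
  sum (map g (F x)) + sum (map g (concatMap F xs))
    ≡⟨ cong (sum (map g (F x)) +_) (sum-map-concatMap g F xs) ⟩
  sum (map g (F x)) + sum (map (λ y → sum (map g (F y))) xs) ∎
  where open ≡-Reasoning

concatMap-upTo-suc : (F : ℕ → List A) (n : ℕ) →
  concatMap F (upTo (suc n)) ≡ F 0 ++ concatMap (F ∘ suc) (upTo n)
concatMap-upTo-suc F n =
  cong (λ xss → F 0 ++ concat xss) (trans (map-applyUpTo suc F n) (sym (map-applyUpTo id (F ∘ suc) n)))

concatMap-upTo-cong : ∀ n {F G : ℕ → List A} → (∀ {j} → j < n → F j ≡ G j) →
  concatMap F (upTo n) ≡ concatMap G (upTo n)
concatMap-upTo-cong n eq = cong concat (map-cong-local (applyUpTo⁺₁ id n eq))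

concatMap-regroup : (E O : ℕ → List A) (n : ℕ) →
  concatMap (λ k → E k ++ O k) (upTo (suc n)) ≡ E 0 ++ (concatMap (λ k → O k ++ E (suc k)) (upTo n) ++ O n)
concatMap-regroup E O zero    = ++-identityʳ (E 0 ++ O 0)
concatMap-regroup E O (suc n) = begin
  concatMap (λ k → E k ++ O k) (upTo (suc (suc n)))
    ≡⟨ concatMap-upTo-suc (λ k → E k ++ O k) (suc n) ⟩
  (E 0 ++ O 0) ++ concatMap (λ k → E (suc k) ++ O (suc k)) (upTo (suc n))
    ≡⟨ cong ((E 0 ++ O 0) ++_) (concatMap-regroup (E ∘ suc) (O ∘ suc) n) ⟩
  (E 0 ++ O 0) ++ (E 1 ++ (middle ++ O (suc n)))
    ≡⟨ ++-assoc (E 0) (O 0) _ ⟩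
  E 0 ++ (O 0 ++ (E 1 ++ (middle ++ O (suc n))))
    ≡⟨ cong (E 0 ++_) (trans (sym (++-assoc (O 0) (E 1) _)) (sym (++-assoc (O 0 ++ E 1) middle _))) ⟩
  E 0 ++ (((O 0 ++ E 1) ++ middle) ++ O (suc n))
    ≡⟨ cong (λ xs → E 0 ++ (xs ++ O (suc n))) (sym (concatMap-upTo-suc (λ k → O k ++ E (suc k)) n)) ⟩
  E 0 ++ (concatMap (λ k → O k ++ E (suc k)) (upTo (suc n)) ++ O (suc n)) ∎
  where
  open ≡-Reasoning
  middle = concatMap (λ k → O (suc k) ++ E (suc (suc k))) (upTo n)

sumFin-suc : ∀ {n} (f : Fin (suc n) → ℕ) → sumFin f ≡ f zero + sumFin (f ∘ suc)
sumFin-suc f =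
  cong (λ xs → f zero + sum xs) (trans (map-tabulate suc f) (sym (map-tabulate id (f ∘ suc))))

sumFin-cong : ∀ {n} {f g : Fin n → ℕ} → (∀ i → f i ≡ g i) → sumFin f ≡ sumFin g
sumFin-cong {n} eq = cong sum (map-cong eq (allFin n))

sumFin-zero : ∀ n → sumFin {n} (λ _ → 0) ≡ 0
sumFin-zero zero    = refl
sumFin-zero (suc n) = trans (sumFin-suc {n} (λ _ → 0)) (sumFin-zero n)

sumFin-lookup : (xs : List C) (g : C → ℕ) → sumFin (g ∘ lookup xs) ≡ sum (map g xs)
sumFin-lookup []       g = refl
sumFin-lookup (x ∷ xs) g = trans (sumFin-suc (g ∘ lookup (x ∷ xs))) (cong (g x +_) (sumFin-lookup xs g))

⌊≟⌋≡toℕ-≡ᵇ : ∀ {n} (x y : Fin n) → ⌊ x Fin.≟ y ⌋ ≡ (toℕ x ≡ᵇ toℕ y)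
⌊≟⌋≡toℕ-≡ᵇ zero    zero    = refl
⌊≟⌋≡toℕ-≡ᵇ zero    (suc y) = refl
⌊≟⌋≡toℕ-≡ᵇ (suc x) zero    = refl
⌊≟⌋≡toℕ-≡ᵇ (suc x) (suc y) = trans (⌊⌋-map′ _ _ (x Fin.≟ y)) (⌊≟⌋≡toℕ-≡ᵇ x y)

-- Counting points of intervals

-- Stated with _<ᵇ_ so that inInterval (suc s) len (suc r) reduces to
-- inInterval s len r: the counting lemmas below are plain inductions.
inInterval : ℕ → ℕ → ℕ → Bool
inInterval s len r = not (r <ᵇ s) ∧ (r <ᵇ s + len)

inInterval⇒0<len : ∀ s len r → inInterval s len r ≡ true → 0 < len
inInterval⇒0<len zero    (suc len) r       _ = z<s
inInterval⇒0<len (suc s) len       (suc r) e = inInterval⇒0<len s len r e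

inInterval-empty : ∀ s r → inInterval s 0 r ≡ false
inInterval-empty zero    r       = refl
inInterval-empty (suc s) zero    = refl
inInterval-empty (suc s) (suc r) = inInterval-empty s r

inInterval-++ : ∀ s a b r →
  ind (inInterval s a r) + ind (inInterval (s + a) b r) ≡ ind (inInterval s (a + b) r)
inInterval-++ zero    zero    b r       = refl
inInterval-++ zero    (suc a) b zero    = refl
inInterval-++ zero    (suc a) b (suc r) = inInterval-++ zero a b r
inInterval-++ (suc s) a       b zero    = refl
inInterval-++ (suc s) a       b (suc r) = inInterval-++ s a b r

count-below : ∀ n k → k ≤ n → ∑ n (λ r → ind (r <ᵇ k)) ≡ k
count-below n       zero    _         = ∑-zero n
count-below (suc n) (suc k) (s≤s k≤n) = cong suc (count-below n k k≤n)

count-above : ∀ n p → ∑ n (λ q → ind (p <ᵇ q)) ≡ n ∸ suc p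
count-above zero    p       = refl
count-above (suc n) zero    = ∑-one n
count-above (suc n) (suc p) = count-above n p

count-interval : ∀ n s len → s + len ≤ n → ∑ n (ind ∘ inInterval s len) ≡ len
count-interval n       zero    len le        = count-below n len le
count-interval (suc n) (suc s) len (s≤s le) = count-interval n s len le

-- Intervals of lengths l laid end to end from s.
start : ∀ {n} → ℕ → (Fin n → ℕ) → Fin n → ℕ
start s l zero    = s
start s l (suc i) = start (s + l zero) (l ∘ suc) i

start+≤ : ∀ {n} s (l : Fin n → ℕ) i → start s l i + l i ≤ s + sumFin l
start+≤ s l zero    = +-monoʳ-≤ s (≤-trans (m≤m+n (l zero) _) (≤-reflexive (sym (sumFin-suc l))))
start+≤ s l (suc i) = ≤-trans (start+≤ (s + l zero) (l ∘ suc) i)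
  (≤-reflexive (trans (+-assoc s (l zero) _) (cong (s +_) (sym (sumFin-suc l)))))

intervals-tile : ∀ {n} s (l : Fin n → ℕ) r →
  sumFin (λ i → ind (inInterval (start s l i) (l i) r)) ≡ ind (inInterval s (sumFin l) r)
intervals-tile {zero}  s l r = cong ind (sym (inInterval-empty s r))
intervals-tile {suc n} s l r = begin
  sumFin (λ i → ind (inInterval (start s l i) (l i) r))
    ≡⟨ sumFin-suc (λ i → ind (inInterval (start s l i) (l i) r)) ⟩
  ind (inInterval s (l zero) r) + sumFin (λ i → ind (inInterval (start (s + l zero) (l ∘ suc) i) (l (suc i)) r))
    ≡⟨ cong (ind (inInterval s (l zero) r) +_) (intervals-tile (s + l zero) (l ∘ suc) r) ⟩
  ind (inInterval s (l zero) r) + ind (inInterval (s + l zero) (sumFin (l ∘ suc)) r)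
    ≡⟨ inInterval-++ s (l zero) (sumFin (l ∘ suc)) r ⟩
  ind (inInterval s (l zero + sumFin (l ∘ suc)) r)
    ≡⟨ cong (λ len → ind (inInterval s len r)) (sym (sumFin-suc l)) ⟩
  ind (inInterval s (sumFin l) r) ∎
  where open ≡-Reasoning

-- Dags on the positions of a list

ranked⇒dag : ∀ {n} (G : Digraph n) (rank : Fin n → ℕ) →
  (∀ {u v} → Arc G u v → rank u < rank v) → IsDag G
ranked⇒dag G rank increasing = (λ v a → <-irrefl refl (increasing a)) , (λ v p → <-irrefl refl (along p))
  where
  along : ∀ {u v} → TransClosure (Arc G) u v → rank u < rank v
  along [ a ]   = increasing a
  along (a ∷ p) = <-trans (increasing a) (along p)

labelled : (xs : List C) → (C → C → Bool) → Digraph (length xs)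
labelled xs arc u v = arc (lookup xs u) (lookup xs v)

lookup-map : {D : Set} (f : C → D) (xs : List C) (i : Fin (length xs)) →
  lookup (map f xs) (cast (sym (length-map f xs)) i) ≡ f (lookup xs i)
lookup-map f (x ∷ xs) zero    = refl
lookup-map f (x ∷ xs) (suc i) = lookup-map f xs i

cast-inverse : ∀ {m n} (e : m ≡ n) (i : Fin m) → cast (sym e) (cast e i) ≡ i
cast-inverse e i = trans (cast-trans e (sym e) i) (cast-is-id _ i)

module _ (xs : List C) (arc : C → C → Bool) (degree : C → ℕ × ℕ) where

  private
    G : Digraph (length xs)
    G = labelled xs arc

  labelled-realizes :
    (∀ i → indeg G i ≡ proj₁ (degree (lookup xs i)) × outdeg G i ≡ proj₂ (degree (lookup xs i))) →
    Realizes (length xs) G (map degree xs)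
  labelled-realizes degrees =
    cast e , cast (sym e) , cast-inverse e , cast-inverse (sym e) ,
    λ i → let in≡ , out≡ = degrees i; lookup≡ = lookup-map degree xs i in
          trans in≡ (cong proj₁ (sym lookup≡)) , trans out≡ (cong proj₂ (sym lookup≡))
    where
    e : length xs ≡ length (map degree xs)
    e = sym (length-map degree xs)

  labelled-dag-realization : (Valid : C → Set) → All Valid xs → (rank : C → ℕ) →
    (∀ {c d} → Valid c → Valid d → arc c d ≡ true → rank c < rank d) →
    (∀ {c} → Valid c → sum (map (λ u → ind (arc u c)) xs) ≡ proj₁ (degree c)) →
    (∀ {c} → Valid c → sum (map (λ u → ind (arc c u)) xs) ≡ proj₂ (degree c)) →
    HasDagRealization (map degree xs)
  labelled-dag-realization Valid valid rank increasing indegree outdegree =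
    length xs , G , ranked⇒dag G (rank ∘ lookup xs) (increasing (valid-at _) (valid-at _)) ,
    labelled-realizes λ i →
      trans (sumFin-lookup xs (λ u → ind (arc u (lookup xs i)))) (indegree (valid-at i)) ,
      trans (sumFin-lookup xs (λ u → ind (arc (lookup xs i) u))) (outdegree (valid-at i))
    where
    valid-at : ∀ i → Valid (lookup xs i)
    valid-at i = All.lookup valid (∈-lookup i)

-- The construction

Xᵢ-low Xᵢ-high : ℕ → ℕ → ℕ → DegSeq
Xᵢ-low  m B i = map (λ j → ((2 * i ∸ 1) * B + j + 1 , (2 * m ∸ 2 * i + 1) * B ∸ 1 ∸ j)) (upTo B)
Xᵢ-high m B i = map (λ j → ((2 * i ∸ 1) * B + j , (2 * m ∸ 2 * i + 1) * B ∸ j)) (map (B +_) (upTo B))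

Xₘ≡Xᵢ-low : ∀ m B → Xₘ m B ≡ Xᵢ-low m B m
Xₘ≡Xᵢ-low m B = cong (λ c → map (λ j → ((2 * m ∸ 1) * B + j + 1 , c ∸ 1 ∸ j)) (upTo B))
  (sym (trans (cong (λ n → (n + 1) * B) (n∸n≡0 (2 * m))) (*-identityˡ B)))

2*[1+j]∸1≡2*j+1 : ∀ j → 2 * suc j ∸ 1 ≡ 2 * j + 1
2*[1+j]∸1≡2*j+1 j = trans (+-suc j (j + 0)) (+-comm 1 (2 * j))

[2m∸2[1+j]+1]B∸x : ∀ {m} j B x → suc j ≤ m →
  (2 * m ∸ 2 * suc j + 1) * B ∸ x ≡ m * (B + B) ∸ ((2 * j + 1) * B + x)
[2m∸2[1+j]+1]B∸x j B x 1+j≤m with m≤n⇒∃[o]m+o≡n 1+j≤m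
... | d , refl = begin
  (2 * (suc j + d) ∸ 2 * suc j + 1) * B ∸ x
    ≡⟨ cong (λ n → (n + 1) * B ∸ x) 2[1+j+d]∸2[1+j]≡2d ⟩
  (2 * d + 1) * B ∸ x
    ≡⟨ sym ([m+n]∸[m+o]≡n∸o ((2 * j + 1) * B) ((2 * d + 1) * B) x) ⟩
  (2 * j + 1) * B + (2 * d + 1) * B ∸ ((2 * j + 1) * B + x)
    ≡⟨ cong (_∸ ((2 * j + 1) * B + x)) (ring j d B) ⟩
  (suc j + d) * (B + B) ∸ ((2 * j + 1) * B + x) ∎
  where
  open ≡-Reasoning
  2[1+j+d]∸2[1+j]≡2d : 2 * (suc j + d) ∸ 2 * suc j ≡ 2 * d
  2[1+j+d]∸2[1+j]≡2d = trans (cong (_∸ 2 * suc j) (*-distribˡ-+ 2 (suc j) d)) (m+n∸m≡n (2 * suc j) (2 * d))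
  ring : ∀ j d B → (2 * j + 1) * B + (2 * d + 1) * B ≡ (suc j + d) * (B + B)
  ring = solve-∀

data Side : Set where
  before after : Side

module Construction (m B : ℕ) (a : Fin (3 * m) → ℕ) (t : Fin (3 * m) → Fin m) where

  N : ℕ
  N = m * (B + B)

  weight : ℕ → Fin (3 * m) → ℕ
  weight k i = if toℕ (t i) ≡ᵇ k then a i else 0

  -- The elements of triple k share out the B vertices of each of the two
  -- segments of block k in consecutive runs of lengths aᵢ (empty runs for
  -- the other elements).
  slot : ℕ → Fin (3 * m) → ℕ → Bool
  slot k i r = inInterval (start 0 (weight k) i) (weight k i) r

  -- chain before k r and chain after k r are the chain vertices at
  -- positions 2kB + r and 2kB + B + r, i.e. x_k^{B+r} (x_0^r if k = 0)
  -- and x_{k+1}^r in the paper's notation.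
  data Vertex : Set where
    elem  : Fin (3 * m) → Vertex
    chain : Side → ℕ → ℕ → Vertex

  within : Side → ℕ → ℕ
  within before r = r
  within after  r = B + r

  position : Side → ℕ → ℕ → ℕ
  position s k r = k * (B + B) + within s r

  -- The chain clause comes first so that arcs between chain vertices
  -- reduce without a case split on their sides.
  arc : Vertex → Vertex → Bool
  arc (chain s k r)      (chain s′ k′ r′) = position s k r <ᵇ position s′ k′ r′
  arc (chain before k r) (elem i)         = slot k i r
  arc (chain after _ _)  (elem _)         = false
  arc (elem i)           (chain after k r) = slot k i r
  arc (elem _)           _                = false

  degree : Vertex → ℕ × ℕ
  degree (elem i)           = a i , a i
  degree (chain before k r) = position before k r , N ∸ position before k r
  degree (chain after k r)  = suc (position after k r) , N ∸ suc (position after k r)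

  -- Ranks are doubled so that the elements of triple k fit strictly
  -- between the two segments of block k.
  rank : Vertex → ℕ
  rank (elem i)      = 2 * (toℕ (t i) * (B + B) + B)
  rank (chain s k r) = suc (2 * position s k r)

  Valid : Vertex → Set
  Valid (elem _)      = ⊤
  Valid (chain _ k r) = k < m × r < B

  segment : Side → ℕ → List Vertex
  segment s k = map (chain s k) (upTo B)

  vertices : List Vertex
  vertices = map elem (allFin (3 * m)) ++ concatMap (λ k → segment before k ++ segment after k) (upTo m)

  all-valid : All Valid vertices
  all-valid = ++⁺ (map⁺ (tabulate⁺ (λ _ → tt)))
    (concat⁺ (map⁺ (applyUpTo⁺₁ id m λ k<m → ++⁺ (valid-segment before k<m) (valid-segment after k<m))))
    where
    valid-segment : ∀ s {k} → k < m → All Valid (segment s k)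
    valid-segment s k<m = map⁺ (applyUpTo⁺₁ id B (k<m ,_))

  slot⇒block : ∀ {k i r} → slot k i r ≡ true → toℕ (t i) ≡ k
  slot⇒block {k} {i} {r} e =
    ≡ᵇ⇒≡ (toℕ (t i)) k
      (if-pos (toℕ (t i) ≡ᵇ k) (inInterval⇒0<len (start 0 (weight k) i) (weight k i) r e))
    where
    if-pos : ∀ b → 0 < (if b then a i else 0) → T b
    if-pos true _ = tt

  rank-elem : ∀ {i k} → toℕ (t i) ≡ k → rank (elem i) ≡ 2 * (k * (B + B) + B)
  rank-elem refl = refl

  rank-increasing : ∀ {u v} → Valid u → Valid v → arc u v ≡ true → rank u < rank v
  rank-increasing {chain s k r} {chain s′ k′ r′} _ _ e =
    s≤s (*-monoʳ-< 2 (<ᵇ⇒< (position s k r) (position s′ k′ r′) (Equivalence.from T-≡ e)))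
  rank-increasing {chain before k r} {elem i} (_ , r<B) _ e =
    subst (rank (chain before k r) <_) (sym (rank-elem (slot⇒block {k} {i} {r} e)))
      (≤-trans (≤-reflexive (sym (*-suc 2 (position before k r)))) (*-monoʳ-≤ 2 (+-monoʳ-< (k * (B + B)) r<B)))
  rank-increasing {elem i} {chain after k r} _ _ e =
    subst (_< rank (chain after k r)) (sym (rank-elem (slot⇒block {k} {i} {r} e)))
      (s≤s (*-monoʳ-≤ 2 (+-monoʳ-≤ (k * (B + B)) (m≤m+n B r))))

  position<N : ∀ s {k r} → k < m → r < B → position s k r < N
  position<N s {k} {r} k<m r<B = begin-strict
    k * (B + B) + within s r  <⟨ +-monoʳ-< (k * (B + B)) (within<B+B s) ⟩
    k * (B + B) + (B + B)     ≡⟨ +-comm (k * (B + B)) (B + B) ⟩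
    suc k * (B + B)           ≤⟨ *-monoˡ-≤ (B + B) k<m ⟩
    N                         ∎
    where
    open ≤-Reasoning
    within<B+B : ∀ s → within s r < B + B
    within<B+B before = <-≤-trans r<B (m≤m+n B B)
    within<B+B after  = +-monoʳ-< B r<B

  sum-vertices : (g : Vertex → ℕ) → sum (map g vertices) ≡
    sumFin (g ∘ elem) + ∑ m (λ k → ∑ B (g ∘ chain before k) + ∑ B (g ∘ chain after k))
  sum-vertices g = begin
    sum (map g (elems ++ chains))         ≡⟨ cong sum (map-++ g elems chains) ⟩
    sum (map g elems ++ map g chains)     ≡⟨ sum-++ (map g elems) _ ⟩
    sum (map g elems) + sum (map g chains)
      ≡⟨ cong₂ _+_ (cong sum (sym (map-∘ (allFin (3 * m))))) (sum-map-concatMap g _ (upTo m)) ⟩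
    sumFin (g ∘ elem) + sum (map (λ k → sum (map g (segment before k ++ segment after k))) (upTo m))
      ≡⟨ cong (sumFin (g ∘ elem) +_) (trans (sum-map-upTo m _) (∑-cong m λ {k} _ → sum-block k)) ⟩
    sumFin (g ∘ elem) + ∑ m (λ k → ∑ B (g ∘ chain before k) + ∑ B (g ∘ chain after k)) ∎
    where
    open ≡-Reasoning
    elems chains : List Vertex
    elems  = map elem (allFin (3 * m))
    chains = concatMap (λ k → segment before k ++ segment after k) (upTo m)
    sum-segment : ∀ s k → sum (map g (segment s k)) ≡ ∑ B (g ∘ chain s k)
    sum-segment s k = trans (cong sum (sym (map-∘ (upTo B)))) (sum-map-upTo B (g ∘ chain s k))
    sum-block : ∀ k → sum (map g (segment before k ++ segment after k)) ≡
                      ∑ B (g ∘ chain before k) + ∑ B (g ∘ chain after k)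
    sum-block k = trans (cong sum (map-++ g (segment before k) _))
      (trans (sum-++ (map g (segment before k)) _) (cong₂ _+_ (sum-segment before k) (sum-segment after k)))

  ∑-positions : (h : ℕ → ℕ) →
    ∑ m (λ k → ∑ B (h ∘ position before k) + ∑ B (h ∘ position after k)) ≡ ∑ N h
  ∑-positions h = sym (trans (∑-* m (B + B) h) (∑-cong m λ {k} _ → ∑-+ B B (λ r → h (k * (B + B) + r))))

  sum-by-position : (g : Vertex → ℕ) (h : ℕ → ℕ) →
    (∀ s k r → g (chain s k r) ≡ h (position s k r)) →
    sum (map g vertices) ≡ sumFin (g ∘ elem) + ∑ N h
  sum-by-position g h eq = trans (sum-vertices g) (cong (sumFin (g ∘ elem) +_) (trans
    (∑-cong m λ {k} _ → cong₂ _+_ (∑-cong B λ {r} _ → eq before k r) (∑-cong B λ {r} _ → eq after k r))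
    (∑-positions h)))

  module Degrees (full : ∀ k → k < m → sumFin (weight k) ≡ B) where

    ∑-slot : ∀ {k} i → k < m → ∑ B (ind ∘ slot k i) ≡ weight k i
    ∑-slot {k} i k<m = count-interval B (start 0 (weight k) i) (weight k i)
      (subst (start 0 (weight k) i + weight k i ≤_) (full k k<m) (start+≤ 0 (weight k) i))

    ∑-weight : ∀ i → ∑ m (λ k → weight k i) ≡ a i
    ∑-weight i = ∑-one-hot m (toℕ (t i)) (a i) (toℕ<n (t i))

    slots-tile : ∀ {k r} → k < m → r < B → sumFin (λ i → ind (slot k i r)) ≡ 1
    slots-tile {k} {r} k<m r<B = begin
      sumFin (λ i → ind (slot k i r)) ≡⟨ intervals-tile 0 (weight k) r ⟩
      ind (r <ᵇ sumFin (weight k))    ≡⟨ cong (λ n → ind (r <ᵇ n)) (full k k<m) ⟩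
      ind (r <ᵇ B)                    ≡⟨ cong ind (Equivalence.to T-≡ (<⇒<ᵇ r<B)) ⟩
      1                               ∎
      where open ≡-Reasoning

    indegree : ∀ {v} → Valid v → sum (map (λ u → ind (arc u v)) vertices) ≡ proj₁ (degree v)
    indegree {elem i} _ = begin
      sum (map (λ u → ind (arc u (elem i))) vertices)
        ≡⟨ sum-vertices _ ⟩
      sumFin {3 * m} (λ _ → 0) + ∑ m (λ k → ∑ B (ind ∘ slot k i) + ∑ B (λ _ → 0))
        ≡⟨ cong₂ _+_ (sumFin-zero (3 * m)) (∑-cong m λ k<m → cong₂ _+_ (∑-slot i k<m) (∑-zero B)) ⟩
      ∑ m (λ k → weight k i + 0)
        ≡⟨ ∑-cong m (λ _ → +-identityʳ _) ⟩
      ∑ m (λ k → weight k i)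
        ≡⟨ ∑-weight i ⟩
      a i ∎
      where open ≡-Reasoning
    indegree {chain before k r} (k<m , r<B) =
      trans (sum-by-position _ (λ q → ind (q <ᵇ position before k r)) (λ _ _ _ → refl))
            (cong₂ _+_ (sumFin-zero (3 * m)) (count-below N _ (<⇒≤ (position<N before k<m r<B))))
    indegree {chain after k r} (k<m , r<B) =
      trans (sum-by-position _ (λ q → ind (q <ᵇ position after k r)) (λ _ _ _ → refl))
            (cong₂ _+_ (slots-tile k<m r<B) (count-below N _ (<⇒≤ (position<N after k<m r<B))))

    outdegree : ∀ {v} → Valid v → sum (map (λ u → ind (arc v u)) vertices) ≡ proj₂ (degree v)
    outdegree {elem i} _ = begin
      sum (map (λ u → ind (arc (elem i) u)) vertices)
        ≡⟨ sum-vertices _ ⟩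
      sumFin {3 * m} (λ _ → 0) + ∑ m (λ k → ∑ B (λ _ → 0) + ∑ B (ind ∘ slot k i))
        ≡⟨ cong₂ _+_ (sumFin-zero (3 * m)) (∑-cong m λ k<m → cong₂ _+_ (∑-zero B) (∑-slot i k<m)) ⟩
      ∑ m (λ k → weight k i)
        ≡⟨ ∑-weight i ⟩
      a i ∎
      where open ≡-Reasoning
    outdegree {chain before k r} (k<m , r<B) =
      trans (sum-by-position _ (λ q → ind (position before k r <ᵇ q)) (λ _ _ _ → refl))
            (trans (cong₂ _+_ (slots-tile k<m r<B) (count-above N _))
                   (sym (+-∸-assoc 1 (position<N before k<m r<B))))
    outdegree {chain after k r} (k<m , r<B) =
      trans (sum-by-position _ (λ q → ind (position after k r <ᵇ q)) (λ _ _ _ → refl))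
            (cong₂ _+_ (sumFin-zero (3 * m)) (count-above N _))

  block-sums : (∀ κ → sumFin (λ i → if ⌊ t i Fin.≟ κ ⌋ then a i else 0) ≡ B) →
    ∀ k → k < m → sumFin (weight k) ≡ B
  block-sums sums k k<m =
    trans (sumFin-cong λ i → cong (λ b → if b then a i else 0) (same-block i)) (sums (fromℕ< k<m))
    where
    same-block : ∀ i → (toℕ (t i) ≡ᵇ k) ≡ ⌊ t i Fin.≟ fromℕ< k<m ⌋
    same-block i =
      sym (trans (⌊≟⌋≡toℕ-≡ᵇ (t i) (fromℕ< k<m)) (cong (toℕ (t i) ≡ᵇ_) (toℕ-fromℕ< k<m)))

  X₀-segment : map degree (segment before 0) ≡ X₀ m B
  X₀-segment = trans (sym (map-∘ (upTo B))) (cong (λ n → map (λ r → r , n ∸ r) (upTo B)) (ring m B))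
    where
    ring : ∀ m B → m * (B + B) ≡ 2 * m * B
    ring = solve-∀

  Xᵢ-low-segment : ∀ {j} → j < m → map degree (segment after j) ≡ Xᵢ-low m B (suc j)
  Xᵢ-low-segment {j} j<m =
    trans (sym (map-∘ (upTo B))) (map-cong (λ r → cong₂ _,_ (sym (indeg≡ r)) (sym (outdeg≡ r))) (upTo B))
    where
    open ≡-Reasoning
    ring₁ : ∀ j B r → (2 * j + 1) * B + r + 1 ≡ suc (j * (B + B) + (B + r))
    ring₁ = solve-∀
    ring₂ : ∀ j B r → (2 * j + 1) * B + suc r ≡ suc (j * (B + B) + (B + r))
    ring₂ = solve-∀
    indeg≡ : ∀ r → (2 * suc j ∸ 1) * B + r + 1 ≡ suc (position after j r)
    indeg≡ r = trans (cong (λ c → c * B + r + 1) (2*[1+j]∸1≡2*j+1 j)) (ring₁ j B r)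
    outdeg≡ : ∀ r → (2 * m ∸ 2 * suc j + 1) * B ∸ 1 ∸ r ≡ N ∸ suc (position after j r)
    outdeg≡ r = begin
      (2 * m ∸ 2 * suc j + 1) * B ∸ 1 ∸ r  ≡⟨ ∸-+-assoc ((2 * m ∸ 2 * suc j + 1) * B) 1 r ⟩
      (2 * m ∸ 2 * suc j + 1) * B ∸ suc r  ≡⟨ [2m∸2[1+j]+1]B∸x j B (suc r) j<m ⟩
      N ∸ ((2 * j + 1) * B + suc r)        ≡⟨ cong (N ∸_) (ring₂ j B r) ⟩
      N ∸ suc (position after j r)         ∎

  Xᵢ-high-segment : ∀ {j} → suc j < m → map degree (segment before (suc j)) ≡ Xᵢ-high m B (suc j)
  Xᵢ-high-segment {j} 1+j<m = trans (sym (map-∘ (upTo B)))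
    (trans (map-cong (λ r → cong₂ _,_ (sym (indeg≡ r)) (sym (outdeg≡ r))) (upTo B)) (map-∘ (upTo B)))
    where
    ring : ∀ j B r → (2 * j + 1) * B + (B + r) ≡ suc j * (B + B) + r
    ring = solve-∀
    indeg≡ : ∀ r → (2 * suc j ∸ 1) * B + (B + r) ≡ position before (suc j) r
    indeg≡ r = trans (cong (λ c → c * B + (B + r)) (2*[1+j]∸1≡2*j+1 j)) (ring j B r)
    outdeg≡ : ∀ r → (2 * m ∸ 2 * suc j + 1) * B ∸ (B + r) ≡ N ∸ position before (suc j) r
    outdeg≡ r = trans ([2m∸2[1+j]+1]B∸x j B (B + r) (<⇒≤ 1+j<m)) (cong (N ∸_) (ring j B r))

module _ (m′ B : ℕ) (a : Fin (3 * suc m′) → ℕ) (t : Fin (3 * suc m′) → Fin (suc m′)) where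

  open Construction (suc m′) B a t

  degree-sequence : map degree vertices ≡ constructS (suc m′) B a
  degree-sequence = begin
    map degree (map elem (allFin (3 * suc m′)) ++ chains)
      ≡⟨ map-++ degree (map elem (allFin (3 * suc m′))) chains ⟩
    map degree (map elem (allFin (3 * suc m′))) ++ map degree chains
      ≡⟨ cong₂ _++_ (sym (map-∘ (allFin (3 * suc m′)))) (map-concatMap degree _ (upTo (suc m′))) ⟩
    αs ++ concatMap (map degree ∘ block) (upTo (suc m′))
      ≡⟨ cong (αs ++_) (concatMap-cong (λ k → map-++ degree (segment before k) _) (upTo (suc m′))) ⟩
    αs ++ concatMap (λ k → D before k ++ D after k) (upTo (suc m′))
      ≡⟨ cong (αs ++_) (concatMap-regroup (D before) (D after) m′) ⟩
    αs ++ D before 0 ++ (concatMap (λ j → D after j ++ D before (suc j)) (upTo m′) ++ D after m′)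
      ≡⟨ cong (αs ++_) (cong₂ _++_ X₀-segment (cong₂ _++_ middle last)) ⟩
    constructS (suc m′) B a ∎
    where
    open ≡-Reasoning
    αs : DegSeq
    αs = map (λ i → a i , a i) (allFin (3 * suc m′))
    block : ℕ → List Vertex
    block k = segment before k ++ segment after k
    chains : List Vertex
    chains = concatMap block (upTo (suc m′))
    D : Side → ℕ → DegSeq
    D s k = map degree (segment s k)
    middle : concatMap (λ j → D after j ++ D before (suc j)) (upTo m′) ≡
             concatMap (Xᵢ (suc m′) B) (map suc (upTo m′))
    middle = trans
      (concatMap-upTo-cong m′ λ j<m′ →
        cong₂ _++_ (Xᵢ-low-segment (m<n⇒m<1+n j<m′)) (Xᵢ-high-segment (s<s j<m′)))
      (sym (concatMap-map (Xᵢ (suc m′) B) suc (upTo m′)))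
    last : D after m′ ≡ Xₘ (suc m′) B
    last = trans (Xᵢ-low-segment (n<1+n m′)) (sym (Xₘ≡Xᵢ-low (suc m′) B))

lemma2 : (m B : ℕ) (a : Fin (3 * m) → ℕ) →
    1 ≤ m →
    Is3PartitionInstance m B a →
    Yes3Partition m B a →
    HasDagRealization (constructS m B a)
lemma2 (suc m′) B a _ _ (t , partition) =
  subst HasDagRealization (degree-sequence m′ B a t)
    (labelled-dag-realization vertices arc degree Valid all-valid rank rank-increasing indegree outdegree)
  where
  open Construction (suc m′) B a t
  open Degrees (block-sums (proj₂ ∘ partition))
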